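{- Let $n\geq 3$ be an integer. There is no $n$-tuple $(x_1,\ldots,x_n)$ of positive integers with $x_1\leq\cdots\leq x_n$, satisfying $\sigma_2(x_1,\ldots,x_n)=\sigma_n(x_1,\ldots,x_n)$, in which exactly $i$ of the entries are different from $1$ for some $i\in\{0,1,2\}$. In other words, $S_0(n)=S_1(n)=S_2(n)=\emptyset$.
   Context: $\sigma_k$ denotes the $k$-th elementary symmetric polynomial in $n$ variables. $S(n)$ is the set of $n$-tuples $(x_1,\ldots,x_n)$ of positive integers with $x_1\leq\cdots\leq x_n$ and $\sigma_2(x_1,\ldots,x_n)=\sigma_n(x_1,\ldots,x_n)$. For $i\in\{0,\ldots,n\}$, $S_i(n)$ is the set of $(x_1,\ldots,x_n)\in S(n)$ with $x_1=\cdots=x_{n-i}=1$ and $2\leq x_{n-i+1}\leq\cdots\leq x_n$ (i.e. exactly $i$ entries differ from $1$). -}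

module Defs where

open import Data.Nat using (ℕ; zero; suc; _+_; _*_; _∸_; _≤_; _<_)
open import Data.Vec using (Vec; []; _∷_; lookup)
open import Data.Fin using (Fin; toℕ)
open import Data.Product using (_×_)
open import Relation.Binary.PropositionalEquality using (_≡_)

-- k-th elementary symmetric polynomial of the entries of a vector
-- σ 0 v = 1,  σ (k+1) [] = 0,  σ (k+1) (x ∷ xs) = x * σ k xs + σ (k+1) xs
σ : ∀ {n} → ℕ → Vec ℕ n → ℕ
σ zero    _        = 1
σ (suc k) []       = 0
σ (suc k) (x ∷ xs) = x * σ k xs + σ (suc k) xs

InS : (n : ℕ) → Vec ℕ n → Set
InS n x =
  ((j : Fin n) → 1 ≤ lookup x j) ×
  ((j k : Fin n) → toℕ j ≤ toℕ k → lookup x j ≤ lookup x k) ×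
  (σ 2 x ≡ σ n x)

InSi : (n i : ℕ) → Vec ℕ n → Set
InSi n i x =
  InS n x ×
  ((j : Fin n) → toℕ j < n ∸ i → lookup x j ≡ 1) ×
  ((j : Fin n) → n ∸ i ≤ toℕ j → 2 ≤ lookup x j)

{-# OPTIONS --safe #-}
module Submission where

-- Peeling a leading 1 off a vector lowers the top coefficient, σₙ₊₁ (1 ∷ xs) = σₙ xs,
-- but not σ₂, since σ₂ (1 ∷ xs) = σ₁ xs + σ₂ xs.  So σₙ ≤ σ₂ whenever all but the
-- last two entries are 1, and the inequality is strict as soon as at least one 1 is
-- peeled off a vector whose remaining entries are positive, i.e. as soon as n ≥ 3.

open import Defs
open import Data.Nat using (ℕ; zero; suc; _+_; _≤_; _<_; z≤n; s≤s)
open import Data.Nat.Properties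
open import Data.Vec using (Vec; []; _∷_; lookup)
open import Data.Fin using (Fin; toℕ) renaming (zero to fzero; suc to fsuc)
open import Data.Product using (_,_)
open import Relation.Nullary using (¬_)
open import Relation.Binary.PropositionalEquality using (_≡_; refl; sym; trans; cong₂)

σ-vanishes : ∀ {n} k (xs : Vec ℕ n) → n < k → σ k xs ≡ 0
σ-vanishes (suc k) []       _       = refl
σ-vanishes (suc k) (x ∷ xs) (s≤s n<k)
  rewrite σ-vanishes k xs n<k | σ-vanishes (suc k) xs (m<n⇒m<1+n n<k) | *-zeroʳ x = refl

σ-top-cons-one : ∀ {n} (xs : Vec ℕ n) → σ (suc n) (1 ∷ xs) ≡ σ n xs
σ-top-cons-one {n} xs =
  trans (cong₂ _+_ (*-identityˡ (σ n xs)) (σ-vanishes (suc n) xs ≤-refl)) (+-identityʳ (σ n xs))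

σ₂-cons-one : ∀ {n} (xs : Vec ℕ n) → σ 2 (1 ∷ xs) ≡ σ 1 xs + σ 2 xs
σ₂-cons-one xs = cong₂ _+_ (*-identityˡ (σ 1 xs)) refl

σ₁-positive : ∀ {n} (xs : Vec ℕ (suc n)) → 1 ≤ lookup xs fzero → 1 ≤ σ 1 xs
σ₁-positive (x ∷ xs) 1≤x = ≤-trans 1≤x (≤-trans (≤-reflexive (sym (*-identityʳ x))) (m≤m+n _ _))

OnesBelow : ∀ {n} → ℕ → Vec ℕ n → Set
OnesBelow {n} k xs = (j : Fin n) → toℕ j < k → lookup xs j ≡ 1

OnesBelow-head : ∀ {n k x} {xs : Vec ℕ n} → OnesBelow (suc k) (x ∷ xs) → x ≡ 1
OnesBelow-head ones = ones fzero (s≤s z≤n)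

OnesBelow-tail : ∀ {n k x} {xs : Vec ℕ n} → OnesBelow (suc k) (x ∷ xs) → OnesBelow k xs
OnesBelow-tail ones j j<k = ones (fsuc j) (s≤s j<k)

OnesBelow-mono : ∀ {n k l} {xs : Vec ℕ n} → k ≤ l → OnesBelow l xs → OnesBelow k xs
OnesBelow-mono k≤l ones j j<k = ones j (≤-trans j<k k≤l)

σ-top≤σ₂ : ∀ k (xs : Vec ℕ (2 + k)) → OnesBelow k xs → σ (2 + k) xs ≤ σ 2 xs
σ-top≤σ₂ zero    xs       _    = ≤-refl
σ-top≤σ₂ (suc k) (x ∷ xs) ones rewrite OnesBelow-head ones = begin
  σ (3 + k) (1 ∷ xs)  ≡⟨ σ-top-cons-one xs ⟩
  σ (2 + k) xs        ≤⟨ σ-top≤σ₂ k xs (OnesBelow-tail ones) ⟩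
  σ 2 xs              ≤⟨ m≤n+m (σ 2 xs) (σ 1 xs) ⟩
  σ 1 xs + σ 2 xs     ≡⟨ σ₂-cons-one xs ⟨
  σ 2 (1 ∷ xs)        ∎
  where open ≤-Reasoning

σ-top<σ₂ : ∀ k (xs : Vec ℕ (3 + k)) → OnesBelow (suc k) xs → 1 ≤ lookup xs (fsuc fzero) →
           σ (3 + k) xs < σ 2 xs
σ-top<σ₂ k (x ∷ xs) ones 1≤x₂ rewrite OnesBelow-head ones = begin-strict
  σ (3 + k) (1 ∷ xs)  ≡⟨ σ-top-cons-one xs ⟩
  σ (2 + k) xs        ≤⟨ σ-top≤σ₂ k xs (OnesBelow-tail ones) ⟩
  σ 2 xs              <⟨ m<n+m (σ 2 xs) (σ₁-positive xs 1≤x₂) ⟩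
  σ 1 xs + σ 2 xs     ≡⟨ σ₂-cons-one xs ⟨
  σ 2 (1 ∷ xs)        ∎
  where open ≤-Reasoning

lemma2p2 : (n : ℕ) → 3 ≤ n → (i : ℕ) → i ≤ 2 → (x : Vec ℕ n) → ¬ InSi n i x
lemma2p2 (suc (suc zero))    (s≤s (s≤s ()))
lemma2p2 (suc (suc (suc m))) _ i i≤2 x ((positive , _ , σ₂≡σₙ) , ones , _) =
  <-irrefl (sym σ₂≡σₙ)
    (σ-top<σ₂ m x (OnesBelow-mono {xs = x} (∸-monoʳ-≤ (3 + m) i≤2) ones) (positive (fsuc fzero)))
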